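{- In the uniform profit case of the online interval scheduling problem with satisfaction-based profits, when $m = 2$, for any $\varepsilon > 0$, the competitive ratio of the greedy algorithm $GR$ is at least $4/3 - \varepsilon$; that is, there is an input on which the optimal offline profit is at least $(4/3 - \varepsilon)$ times the profit of $GR$.
   Context: There are $m$ identical machines. Each job $J$ has a release time $r(J)$, a deadline $d(J) > r(J)$ and a profit $v(J)$; in the uniform profit case $v(J) = d(J) - r(J)$ for every job. An algorithm assigns every job to one of the $m$ machines; any number of jobs may be assigned to the same machine and overlap there. If $J$ is on machine $a$ and $[r(J), d(J)]$ is split at all endpoints of intervals of jobs on machine $a$ into pieces $[x_i, x_{i+1}]$, $r(J) = x_1 < \dots < x_b = d(J)$, and $k_i$ is the number of jobs on machine $a$ whose intervals contain $(x_i, x_{i+1})$, the algorithm gains $V(J) = \sum_{i=1}^{b-1} \frac{x_{i+1}-x_i}{d(J)-r(J)} \cdot \frac{v(J)}{k_i}$ from $J$; its total profit is the sum of $V(J)$ over all jobs on the final schedule. Online: jobs are revealed one at a time (not necessarily in order of release time), and each job must be irrevocably assigned to a machine before the next is revealed. The greedy algorithm $GR$ assigns each arriving job $J$ to a machine on which the profit gained from $J$ (computed on the schedule consisting of the previously assigned jobs together with $J$) is largest, breaking ties in favor of the smallest machine index. The competitive ratio of an online algorithm is the supremum over inputs of the optimal offline profit divided by the algorithm's profit. -}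

module Defs where

open import Data.Bool using (Bool; true; false; if_then_else_; _∧_; not)
open import Data.Nat as ℕ using (ℕ; zero; suc)
open import Data.Integer using (+_; +[1+_]; -[1+_])
open import Data.Fin using (Fin; toℕ)
open import Data.List using (List; []; _∷_; _++_; map; foldr; foldl; filterᵇ; length; deduplicate; allFin; [_])
open import Data.Product using (_×_; _,_; proj₁; proj₂)
open import Data.Rational using (ℚ; mkℚ; 0ℚ; 1ℚ; _+_; _-_; _*_; _/_; _<_; _≤ᵇ_; 1/_)
open import Data.Rational.Properties using (_≟_; ≤-decTotalOrder)
open import Data.List.Sort.InsertionSort.Base ≤-decTotalOrder using (sort)

record Job : Set where
  constructor job
  field
    r   : ℚ
    d   : ℚ
    r<d : r < d
open Job public

-- Uniform profit case: v(J) = d(J) - r(J).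
v : Job → ℚ
v J = d J - r J

-- Total reciprocal: inv q = 1/q for q ≠ 0 (and 0 for q = 0; only ever
-- applied to nonzero arguments below).
inv : ℚ → ℚ
inv q@(mkℚ +[1+ _ ] _ _) = 1/ q
inv q@(mkℚ -[1+ _ ] _ _) = 1/ q
inv (mkℚ (+ zero) _ _)   = 0ℚ

_<ᵇ_ : ℚ → ℚ → Bool
p <ᵇ q = not (q ≤ᵇ p)

sumℚ : List ℚ → ℚ
sumℚ = foldr _+_ 0ℚ

pairs : List ℚ → List (ℚ × ℚ)
pairs (x ∷ y ∷ xs) = (x , y) ∷ pairs (y ∷ xs)
pairs _            = []

endpoints : List Job → List ℚ
endpoints = foldr (λ K acc → r K ∷ d K ∷ acc) []

-- breakpoints r(J) = x_1 < ... < x_b = d(J): the endpoints of jobs on the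
-- machine (including J) lying in [r(J), d(J)], sorted and without duplicates
breakpoints : Job → List Job → List ℚ
breakpoints J jobs =
  sort (deduplicate _≟_ (filterᵇ (λ x → (r J ≤ᵇ x) ∧ (x ≤ᵇ d J))
                                  (r J ∷ d J ∷ endpoints jobs)))

-- k_i: number of jobs (counted with multiplicity in the list) whose interval
-- contains the open piece (x , y)
containing : List Job → ℚ → ℚ → ℕ
containing jobs x y = length (filterᵇ (λ K → (r K ≤ᵇ x) ∧ (y ≤ᵇ d K)) jobs)

-- V(J) when the jobs on J's machine (J itself included) are `jobs`:
-- sum over pieces of ((x_{i+1} - x_i) / (d(J) - r(J))) * (v(J) / k_i)
gain : Job → List Job → ℚ
gain J jobs =
  sumℚ (map (λ p → ((proj₂ p - proj₁ p) * inv (d J - r J))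
                   * (v J * inv (+ containing jobs (proj₁ p) (proj₂ p) / 1)))
            (pairs (breakpoints J jobs)))

Schedule : ℕ → Set
Schedule m = List (Job × Fin m)

jobsOn : {m : ℕ} → Schedule m → Fin m → List Job
jobsOn S a = map proj₁ (filterᵇ (λ p → toℕ (proj₂ p) ℕ.≡ᵇ toℕ a) S)

profit : {m : ℕ} → Schedule m → ℚ
profit S = sumℚ (map (λ p → gain (proj₁ p) (jobsOn S (proj₂ p))) S)

-- The greedy choice for a new job J given the previous schedule S:
-- a machine maximizing the gain of J, ties broken by smallest index
-- (scan machines in increasing order, switch only on strict improvement).
greedyChoice : {m : ℕ} → Schedule (suc m) → Job → Fin (suc m)
greedyChoice {m} S J = foldl step Fin.zero (allFin (suc m))
  where
    import Data.Fin as Fin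
    g : Fin (suc m) → ℚ
    g a = gain J (jobsOn S a ++ [ J ])
    step : Fin (suc m) → Fin (suc m) → Fin (suc m)
    step best a = if g best <ᵇ g a then a else best

-- GR run on jobs revealed in list order.
GR : {m : ℕ} → List Job → Schedule (suc m)
GR = foldl (λ S J → S ++ [ (J , greedyChoice S J) ]) []

assign : {m : ℕ} → List Job → List (Fin m) → Schedule m
assign js σ = Data.List.zip js σ
  where import Data.List

module Submission where

-- With uniform profits the gains of the jobs on one machine add up to the
-- length of the union of their intervals. GR, fed the jobs [5,8], [3,4],
-- [0,4], [0,8], [0,4], [0,5] in this order, puts [0,4] twice on machine 1
-- and the other four jobs on machine 0 (the placements of [0,8] and [0,5]
-- are ties resolved towards machine 0), so it covers only [0,8] and [0,4]:
-- profit 8 + 4 = 12. Placing [0,8] alone on machine 1 and everything else on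
-- machine 0 covers [0,8] on both machines: profit 16.

open import Defs
open import Data.Nat using (ℕ)
open import Data.Integer using (+_)
open import Data.Fin using (Fin; zero; suc)
open import Data.List using (List; length; []; _∷_)
open import Data.Product using (Σ; _×_; _,_)
open import Relation.Binary.PropositionalEquality using (_≡_; refl; sym; subst; subst₂)
open import Data.Rational using (ℚ; 0ℚ; NonNegative; _<_; _≤_; _-_; _*_; _/_)
open import Data.Rational.Properties
  using (_<?_; ≤-trans; <⇒≤; ≤-reflexive; +-monoʳ-≤; neg-antimono-≤;
         +-identityʳ; *-monoʳ-≤-nonNeg)
open import Relation.Nullary.Decidable using (True; toWitness)

nat : ℕ → ℚ
nat n = + n / 1

-- The job with interval [a, b]; the side condition a < b is decided by
-- computation, so it can only be used with concrete a < b.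
interval : (a b : ℕ) → {t : True (nat a <? nat b)} → Job
interval a b {t} = job (nat a) (nat b) (toWitness {a? = nat a <? nat b} t)

badInput : List Job
badInput =
  interval 5 8 ∷ interval 3 4 ∷ interval 0 4 ∷
  interval 0 8 ∷ interval 0 4 ∷ interval 0 5 ∷ []

offlineAssignment : List (Fin 2)
offlineAssignment = zero ∷ zero ∷ zero ∷ suc zero ∷ zero ∷ zero ∷ []

-- GR covers [0,8] on machine 0 and only [0,4] on machine 1.
greedyProfit : profit (GR {1} badInput) ≡ nat 12
greedyProfit = refl

-- The offline assignment covers [0,8] on both machines.
offlineProfit : profit (assign badInput offlineAssignment) ≡ nat 16
offlineProfit = refl

shrinkFactor : (c ε p : ℚ) → .{{_ : NonNegative p}} → 0ℚ ≤ ε →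
               (c - ε) * p ≤ c * p
shrinkFactor c ε p 0≤ε = *-monoʳ-≤-nonNeg p c-ε≤c
  where
    c-ε≤c : c - ε ≤ c
    c-ε≤c = ≤-trans (+-monoʳ-≤ c (neg-antimono-≤ 0≤ε))
                    (≤-reflexive (+-identityʳ c))

mainTheorem5 : (ε : ℚ) → 0ℚ < ε →
    Σ (List Job) λ js → Σ (List (Fin 2)) λ σ →
      (length σ ≡ length js) ×
      (0ℚ < profit (GR {1} js)) ×
      (((+ 4 / 3) - ε) * profit (GR {1} js) ≤ profit (assign js σ))
mainTheorem5 ε 0<ε =
  badInput , offlineAssignment , refl , greedyPositive , ratioBound
  where
    greedyPositive : 0ℚ < profit (GR {1} badInput)
    greedyPositive = subst (0ℚ <_) (sym greedyProfit)
                           (toWitness {a? = 0ℚ <? nat 12} _)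

    fourThirdsOfTwelve : (+ 4 / 3) * nat 12 ≡ nat 16
    fourThirdsOfTwelve = refl

    ratioBound : ((+ 4 / 3) - ε) * profit (GR {1} badInput)
                 ≤ profit (assign badInput offlineAssignment)
    ratioBound =
      subst₂ (λ g o → ((+ 4 / 3) - ε) * g ≤ o)
             (sym greedyProfit) (sym offlineProfit)
             (≤-trans (shrinkFactor (+ 4 / 3) ε (nat 12) (<⇒≤ 0<ε))
                      (≤-reflexive fourThirdsOfTwelve))
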